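{- Let $d\ge 1$ and let $U \subset \mathbb{Z}^d$ be finite and odd. If $U$ contains an even vertex, then $|\partial U| \ge 2d(2d-1)$.
   Context: $\mathbb{Z}^d$ is viewed as a graph with nearest-neighbor adjacency. A vertex is odd (even) if its graph distance from the origin is odd (even). $\partial U$ is the set of edges with exactly one endpoint in $U$. A set $U$ is odd if every vertex of $U$ that is adjacent to a vertex outside $U$ is odd. -}

module Defs where

open import Data.Nat using (ℕ; _%_; _+_)
open import Data.Integer as ℤ using (ℤ; ∣_∣) renaming (_+_ to _+ℤ_)
open import Data.Integer.Properties using () renaming (_≟_ to _≟ℤ_)
open import Data.Fin using (Fin)
open import Data.Bool using (Bool; true; false)
open import Data.Vec using (Vec; updateAt; foldr)
open import Data.Vec.Properties using (≡-dec)
open import Data.List using (List; allFin; cartesianProduct; filter; length; _∷_; [])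
open import Data.List.Membership.Propositional using (_∈_; _∉_)
open import Data.List.Membership.DecPropositional using () renaming (_∈?_ to ∈?-gen)
open import Data.Product using (_×_; _,_; ∃)
open import Relation.Binary.PropositionalEquality using (_≡_)
open import Relation.Nullary using (¬?)

Point : ℕ → Set
Point d = Vec ℤ d

dist0 : ∀ {d} → Point d → ℕ
dist0 = foldr _ (λ x n → ∣ x ∣ + n) 0

OddV EvenV : ∀ {d} → Point d → Set
OddV v = dist0 v % 2 ≡ 1
EvenV v = dist0 v % 2 ≡ 0

Dir : ℕ → Set
Dir d = Fin d × Bool

dirs : (d : ℕ) → List (Dir d)
dirs d = cartesianProduct (allFin d) (true ∷ false ∷ [])

step : Bool → ℤ → ℤ
step true  x = x +ℤ ℤ.+ 1
step false x = x +ℤ ℤ.-[1+ 0 ]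

nbr : ∀ {d} → Point d → Dir d → Point d
nbr v (i , s) = updateAt v i (step s)

_∈?_ : ∀ {d} (v : Point d) (U : List (Point d)) → _
_∈?_ {d} = ∈?-gen (≡-dec _≟ℤ_)

-- Edge boundary ∂U of a finite set U (given as a duplicate-free list):
-- the edge {u , nbr u δ} is listed as the pair (u , δ) with u ∈ U and
-- nbr u δ ∉ U; each boundary edge appears exactly once.
boundary : ∀ {d} → List (Point d) → List (Point d × Dir d)
boundary {d} U =
  filter (λ p → ¬? (nbr (Data.Product.proj₁ p) (Data.Product.proj₂ p) ∈? U))
         (cartesianProduct U (dirs d))

IsOddSet : ∀ {d} → List (Point d) → Set
IsOddSet {d} U = ∀ u → u ∈ U → (∃ λ (δ : Dir d) → nbr u δ ∉ U) → OddV u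

-- An even vertex v of an odd set U has all 2d neighbours in U, since otherwise
-- v would be a vertex of U adjacent to the outside and hence odd. For every
-- direction δ and every neighbour v + δ′ with δ′ ≠ −δ, walk from v + δ′ in
-- direction δ; as U is finite the walk leaves U, and its last step is a
-- boundary edge pointing in direction δ. The direction of that edge recovers δ,
-- and the 2d − 1 rays {v + δ′ + kδ : k ≥ 0} with δ′ ≠ −δ are pairwise disjoint,
-- so these 2d(2d − 1) boundary edges are distinct.
module Submission where

open import Defs
open import Data.Nat using (ℕ; zero; suc; z≤n; s≤s; _≤_; _*_; _∸_)
open import Data.List using (List; length)
open import Data.List.Relation.Unary.Unique.Propositional using (Unique)
open import Data.List.Membership.Propositional using (_∈_; _∉_)
open import Data.Product using (∃; _×_; _,_; proj₁; proj₂)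

import Data.Nat.Properties as ℕ
open import Data.Integer using (ℤ; +_; -[1+_]; 0ℤ; ≢-nonZero) renaming (_+_ to _+ℤ_; _*_ to _*ℤ_)
import Data.Integer.Properties as ℤ
open import Algebra.Bundles using (AbelianGroup)
open import Algebra.Properties.Group (AbelianGroup.group ℤ.+-0-abelianGroup) using (∙-cancelˡ)
open import Data.Fin using (Fin; toℕ; punchIn)
import Data.Fin.Properties as Fin
open import Data.Bool using (Bool; true; false; not)
open import Data.Bool.Properties using (¬-not; not-involutive)
open import Data.Vec using (lookup)
open import Data.Vec.Properties using (lookup∘updateAt; lookup∘updateAt′)
import Data.List as List
open import Data.List.Relation.Unary.Any using (here; there; index)
open import Data.List.Relation.Unary.Any.Properties using (lookup-index)
open import Data.List.Membership.Propositional.Properties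
  using (∈-filter⁺; ∈-cartesianProduct⁺; ∈-allFin)
open import Data.Product.Algebra using (×-comm)
open import Data.Product.Function.NonDependent.Propositional using (_×-↔_)
open import Data.Sum using (_⊎_; inj₁; inj₂)
open import Data.Empty using (⊥-elim)
open import Function using (_∘_; Injective; _↔_; Inverse; Injection)
open import Function.Properties.Inverse using (↔-refl; ↔-sym; ↔-trans; ↔⇒↣)
open import Relation.Nullary using (yes; no; ¬?; contradiction)
open import Relation.Binary.PropositionalEquality

injective⇒≤length : ∀ {a} {A : Set a} {m} {xs : List A} (f : Fin m → A) →
  Injective _≡_ _≡_ f → (∀ i → f i ∈ xs) → m ≤ length xs
injective⇒≤length {m = m} {xs} f f-injective f∈xs =
  Fin.injective⇒≤ {f = position} position-injective
  where
  position : Fin m → Fin (length xs)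
  position i = index (f∈xs i)
  position-injective : Injective _≡_ _≡_ position
  position-injective {i} {j} eq = f-injective (begin
    f i                         ≡⟨ lookup-index (f∈xs i) ⟩
    List.lookup xs (position i) ≡⟨ cong (List.lookup xs) eq ⟩
    List.lookup xs (position j) ≡⟨ lookup-index (f∈xs j) ⟨
    f j                         ∎)
    where open ≡-Reasoning

module _ {a} {A : Set a} {n} (ι : A ↔ Fin (suc n)) where
  open Inverse ι

  others : A → Fin n → A
  others x j = from (punchIn (to x) j)

  to-others : ∀ x j → to (others x j) ≡ punchIn (to x) j
  to-others x j = strictlyInverseˡ (punchIn (to x) j)

  others-≢ : ∀ x j → others x j ≢ x
  others-≢ x j eq = Fin.punchInᵢ≢i (to x) j (trans (sym (to-others x j)) (cong to eq))

  others-injective : ∀ x → Injective _≡_ _≡_ (others x)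
  others-injective x {j} {k} eq = Fin.punchIn-injective (to x) j k
    (trans (sym (to-others x j)) (trans (cong to eq) (to-others x k)))

sign : Bool → ℤ
sign true  = + 1
sign false = -[1+ 0 ]

sign≢0 : ∀ s → sign s ≢ 0ℤ
sign≢0 true  ()
sign≢0 false ()

sign-injective : ∀ {s t} → sign s ≡ sign t → s ≡ t
sign-injective {true}  {true}  _ = refl
sign-injective {false} {false} _ = refl

step≡+sign : ∀ s x → step s x ≡ x +ℤ sign s
step≡+sign true  x = refl
step≡+sign false x = refl

step-≢ : ∀ s x → step s x ≢ x
step-≢ s x eq = sign≢0 s (∙-cancelˡ x (sign s) 0ℤ (begin
  x +ℤ sign s ≡⟨ step≡+sign s x ⟨
  step s x     ≡⟨ eq ⟩
  x            ≡⟨ ℤ.+-identityʳ x ⟨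
  x +ℤ 0ℤ     ∎))
  where open ≡-Reasoning

step-injective : ∀ s t x → step s x ≡ step t x → s ≡ t
step-injective s t x eq = sign-injective (∙-cancelˡ x (sign s) (sign t)
  (trans (sym (step≡+sign s x)) (trans eq (step≡+sign t x))))

opp : ∀ {d} → Dir d → Dir d
opp (i , s) = i , not s

∈-dirs : ∀ {d} (δ : Dir d) → δ ∈ dirs d
∈-dirs (i , true)  = ∈-cartesianProduct⁺ (∈-allFin i) (here refl)
∈-dirs (i , false) = ∈-cartesianProduct⁺ (∈-allFin i) (there (here refl))

dirIndex : ∀ {d} → Dir d ↔ Fin (2 * d)
dirIndex {d} = ↔-trans (×-comm (Fin d) Bool)
  (↔-trans (↔-sym Fin.2↔Bool ×-↔ ↔-refl) (↔-sym (Fin.*↔× {2} {d})))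

walk : ∀ {d} → Dir d → ℕ → Point d → Point d
walk δ zero    w = w
walk δ (suc k) w = nbr (walk δ k w) δ

lookup-walk-≢ : ∀ {d} {i j : Fin d} s k w → j ≢ i →
  lookup (walk (i , s) k w) j ≡ lookup w j
lookup-walk-≢         s zero    w j≢i = refl
lookup-walk-≢ {i = i} {j} s (suc k) w j≢i =
  trans (lookup∘updateAt′ j i j≢i (walk (i , s) k w)) (lookup-walk-≢ s k w j≢i)

lookup-walk-≡ : ∀ {d} (i : Fin d) s k w →
  lookup (walk (i , s) k w) i ≡ lookup w i +ℤ + k *ℤ sign s
lookup-walk-≡ i s zero w = sym (trans (cong (lookup w i +ℤ_) (ℤ.*-zeroˡ (sign s)))
                                      (ℤ.+-identityʳ (lookup w i)))
lookup-walk-≡ i s (suc k) w = begin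
  lookup (nbr (walk (i , s) k w) (i , s)) i ≡⟨ lookup∘updateAt i (walk (i , s) k w) ⟩
  step s (lookup (walk (i , s) k w) i)      ≡⟨ step≡+sign s _ ⟩
  lookup (walk (i , s) k w) i +ℤ u         ≡⟨ cong (_+ℤ u) (lookup-walk-≡ i s k w) ⟩
  (x +ℤ + k *ℤ u) +ℤ u                   ≡⟨ ℤ.+-assoc x (+ k *ℤ u) u ⟩
  x +ℤ (+ k *ℤ u +ℤ u)                   ≡⟨ cong (x +ℤ_) (ℤ.+-comm (+ k *ℤ u) u) ⟩
  x +ℤ (u +ℤ + k *ℤ u)                   ≡⟨ cong (x +ℤ_) (ℤ.suc-* (+ k) u) ⟨
  x +ℤ + suc k *ℤ u                       ∎
  where
  open ≡-Reasoning
  x = lookup w i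
  u = sign s

walk-injective : ∀ {d} (δ : Dir d) w → Injective _≡_ _≡_ (λ k → walk δ k w)
walk-injective (i , s) w {k} {m} eq = ℤ.+-injective
  (ℤ.*-cancelʳ-≡ (+ k) (+ m) (sign s) {{≢-nonZero (sign≢0 s)}}
    (∙-cancelˡ (lookup w i) _ _ (begin
      lookup w i +ℤ + k *ℤ sign s ≡⟨ lookup-walk-≡ i s k w ⟨
      lookup (walk (i , s) k w) i   ≡⟨ cong (λ p → lookup p i) eq ⟩
      lookup (walk (i , s) m w) i   ≡⟨ lookup-walk-≡ i s m w ⟩
      lookup w i +ℤ + m *ℤ sign s ∎)))
  where open ≡-Reasoning

nbr-determined : ∀ {d} (v : Point d) {j s} (δ : Dir d) →
  lookup (nbr v δ) j ≡ step s (lookup v j) → δ ≡ (j , s)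
nbr-determined v {j} {s} (j′ , s′) eq with j′ Fin.≟ j
... | yes refl = cong (j ,_) (step-injective s′ s _ (trans (sym (lookup∘updateAt j v)) eq))
... | no j′≢j  = ⊥-elim (step-≢ s _ (trans (sym eq) (lookup∘updateAt′ j j′ (j′≢j ∘ sym) v)))

ray-from-sideways-neighbour : ∀ {d} (v : Point d) {i j s t} k l (δ : Dir d) → j ≢ i →
  walk (i , s) k (nbr v (j , t)) ≡ walk (i , s) l (nbr v δ) → δ ≡ (j , t)
ray-from-sideways-neighbour v {i} {j} {s} {t} k l δ j≢i eq = nbr-determined v δ (begin
  lookup (nbr v δ) j                         ≡⟨ lookup-walk-≢ s l (nbr v δ) j≢i ⟨
  lookup (walk (i , s) l (nbr v δ)) j        ≡⟨ cong (λ p → lookup p j) eq ⟨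
  lookup (walk (i , s) k (nbr v (j , t))) j  ≡⟨ lookup-walk-≢ s k (nbr v (j , t)) j≢i ⟩
  lookup (nbr v (j , t)) j                   ≡⟨ lookup∘updateAt j v ⟩
  step t (lookup v j)                        ∎)
  where open ≡-Reasoning

rays-from-neighbours-disjoint : ∀ {d} (v : Point d) (δ : Dir d) {δ₁ δ₂} k l →
  δ₁ ≢ opp δ → δ₂ ≢ opp δ → walk δ k (nbr v δ₁) ≡ walk δ l (nbr v δ₂) → δ₁ ≡ δ₂
rays-from-neighbours-disjoint v (i , s) {j₁ , t₁} {j₂ , t₂} k l δ₁≢ δ₂≢ eq
  with j₁ Fin.≟ i | j₂ Fin.≟ i
... | no j₁≢i   | _         = sym (ray-from-sideways-neighbour v k l _ j₁≢i eq)
... | yes _     | no j₂≢i   = ray-from-sideways-neighbour v l k _ j₂≢i (sym eq)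
... | yes refl  | yes refl  = cong (i ,_) (trans (along δ₁≢) (sym (along δ₂≢)))
  where
  along : ∀ {t} → (i , t) ≢ (i , not s) → t ≡ s
  along ≢opp = trans (¬-not (≢opp ∘ cong (i ,_))) (not-involutive s)

module _ {d} (U : List (Point d)) where

  ∈-boundary⁺ : ∀ {u δ} → u ∈ U → nbr u δ ∉ U → (u , δ) ∈ boundary U
  ∈-boundary⁺ {δ = δ} u∈U out = ∈-filter⁺ (λ p → ¬? (nbr (proj₁ p) (proj₂ p) ∈? U))
    (∈-cartesianProduct⁺ u∈U (∈-dirs δ)) out

  walk-leaves-or-stays : ∀ δ {w} → w ∈ U → ∀ n →
    (∃ λ k → (walk δ k w , δ) ∈ boundary U) ⊎ (∀ k → k ≤ n → walk δ k w ∈ U)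
  walk-leaves-or-stays δ w∈U zero = inj₂ λ { zero z≤n → w∈U }
  walk-leaves-or-stays δ {w} w∈U (suc n) with walk-leaves-or-stays δ w∈U n
  ... | inj₁ leaves = inj₁ leaves
  ... | inj₂ stays with nbr (walk δ n w) δ ∈? U
  ...   | no  out = inj₁ (n , ∈-boundary⁺ (stays n ℕ.≤-refl) out)
  ...   | yes inn = inj₂ stays′
    where
    stays′ : ∀ k → k ≤ suc n → walk δ k w ∈ U
    stays′ k k≤1+n with ℕ.m≤n⇒m<n∨m≡n k≤1+n
    ... | inj₁ (s≤s k≤n) = stays k k≤n
    ... | inj₂ refl      = inn

  walk-leaves : ∀ δ {w} → w ∈ U → ∃ λ k → (walk δ k w , δ) ∈ boundary U
  walk-leaves δ {w} w∈U with walk-leaves-or-stays δ w∈U (length U)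
  ... | inj₁ leaves = leaves
  ... | inj₂ stays  = contradiction
    (injective⇒≤length (λ k → walk δ (toℕ k) w)
      (Fin.toℕ-injective ∘ walk-injective δ w)
      (λ k → stays (toℕ k) (ℕ.≤-pred (Fin.toℕ<n k))))
    ℕ.1+n≰n

even-vertex-interior : ∀ {d} {U : List (Point d)} → IsOddSet U →
  ∀ {v} → v ∈ U → EvenV v → ∀ δ → nbr v δ ∈ U
even-vertex-interior {U = U} odd {v} v∈U even δ with nbr v δ ∈? U
... | yes inn = inn
... | no  out = contradiction (trans (sym (odd v v∈U (δ , out))) even) λ ()

module _ {d} {U : List (Point d)} {v : Point d} (interior : ∀ δ → nbr v δ ∈ U) where

  exitTime : Dir d → Dir d → ℕ
  exitTime δ δ′ = proj₁ (walk-leaves U δ (interior δ′))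

  exitEdge : Dir d → Dir d → Point d × Dir d
  exitEdge δ δ′ = walk δ (exitTime δ δ′) (nbr v δ′) , δ

  exitEdge-∈ : ∀ δ δ′ → exitEdge δ δ′ ∈ boundary U
  exitEdge-∈ δ δ′ = proj₂ (walk-leaves U δ (interior δ′))

  exitEdge-injective : ∀ {δ₁ δ₁′ δ₂ δ₂′} → δ₁′ ≢ opp δ₁ → δ₂′ ≢ opp δ₂ →
    exitEdge δ₁ δ₁′ ≡ exitEdge δ₂ δ₂′ → δ₁ ≡ δ₂ × δ₁′ ≡ δ₂′
  exitEdge-injective {δ₁} {δ₁′} {_} {δ₂′} ≢₁ ≢₂ eq with cong proj₂ eq
  ... | refl = refl , rays-from-neighbours-disjoint v δ₁
                        (exitTime δ₁ δ₁′) (exitTime δ₁ δ₂′) ≢₁ ≢₂ (cong proj₁ eq)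

module _ {d} {U : List (Point (suc d))} {v : Point (suc d)}
         (interior : ∀ δ → nbr v δ ∈ U) where

  -- others dirIndex typechecks because 2 * suc d reduces to suc (2 * suc d ∸ 1).
  turnEdge : Dir (suc d) × Fin (2 * suc d ∸ 1) → Point (suc d) × Dir (suc d)
  turnEdge (δ , j) = exitEdge interior δ (others dirIndex (opp δ) j)

  turnEdge-injective : Injective _≡_ _≡_ turnEdge
  turnEdge-injective {δ , j} {_ , k} eq
    with exitEdge-injective interior (others-≢ dirIndex (opp δ) j)
                                     (others-≢ dirIndex _ k) eq
  ... | refl , same = cong (δ ,_) (others-injective dirIndex (opp δ) same)

  interior-vertex⇒length-boundary≥ : 2 * suc d * (2 * suc d ∸ 1) ≤ length (boundary U)
  interior-vertex⇒length-boundary≥ = injective⇒≤length (turnEdge ∘ Inverse.to turns)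
    (Injection.injective (↔⇒↣ turns) ∘ turnEdge-injective)
    (λ _ → exitEdge-∈ interior _ _)
    where
    turns : Fin (2 * suc d * (2 * suc d ∸ 1)) ↔ (Dir (suc d) × Fin (2 * suc d ∸ 1))
    turns = ↔-trans Fin.*↔× (↔-sym dirIndex ×-↔ ↔-refl)

corollary1p4 : (d : ℕ) → 1 ≤ d → (U : List (Point d)) → Unique U →
    IsOddSet U → (∃ λ v → v ∈ U × EvenV v) →
    2 * d * (2 * d ∸ 1) ≤ length (boundary U)
corollary1p4 (suc d) _ U _ odd (v , v∈U , even) =
  interior-vertex⇒length-boundary≥ (even-vertex-interior odd v∈U even)
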